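{- A reduced magic square $M$ can be uniquely written as $T_1+\alpha C+\beta D$, where $\alpha\ge -1$ and $\beta\ge 0$ are integers.
   Context: A magic square of order 3 is a $3\times 3$ matrix of distinct nonnegative integers such that every row sum, column sum, and (both) diagonal sums equal the same number $m$. Write $$M=\begin{bmatrix} a_1&a_2&a_3\\ b_1&b_2&b_3\\ c_1&c_2&c_3\end{bmatrix}.$$ $M$ is called reduced if: (C1) every row sum, column sum, and diagonal sum equals $m$; (C2) the entries of $M$ are distinct nonnegative integers; (C3) one of the entries of $M$ is $0$; (C4) $c_3<a_1,a_3,c_1$ and $c_1<a_3$ (equivalently, $c_3<c_1<a_3<a_1$). Here $$C=\begin{bmatrix} 2&0&1\\0&1&2\\1&2&0\end{bmatrix},\quad D=\begin{bmatrix} 3&0&3\\2&2&2\\1&4&1\end{bmatrix},\quad T_1=\begin{bmatrix} 7&0&5\\2&4&6\\3&8&1\end{bmatrix}.$$ -}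

module Defs where

open import Data.Nat using (ℕ; _+_; _<_)
open import Data.Integer as ℤ using (ℤ; +_; -[1+_])
open import Data.Fin using (Fin; zero; suc)
open import Data.Product using (_×_; ∃; ∃-syntax)
open import Relation.Binary.PropositionalEquality using (_≡_)

-- A 3×3 matrix; M i j is the entry in row i, column j (rows a, b, c).
Mat : Set → Set
Mat A = Fin 3 → Fin 3 → A

i0 i1 i2 : Fin 3
i0 = zero
i1 = suc zero
i2 = suc (suc zero)

MagicSums : Mat ℕ → ℕ → Set
MagicSums M m =
  (∀ i → M i i0 + M i i1 + M i i2 ≡ m) ×
  (∀ j → M i0 j + M i1 j + M i2 j ≡ m) ×
  (M i0 i0 + M i1 i1 + M i2 i2 ≡ m) ×
  (M i0 i2 + M i1 i1 + M i2 i0 ≡ m)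

-- (C2) entries are distinct (nonnegativity is built into ℕ)
DistinctEntries : Mat ℕ → Set
DistinctEntries M = ∀ i j k l → M i j ≡ M k l → (i ≡ k × j ≡ l)

HasZero : Mat ℕ → Set
HasZero M = ∃[ i ] ∃[ j ] (M i j ≡ 0)

CornerOrder : Mat ℕ → Set
CornerOrder M =
  (M i2 i2 < M i0 i0) × (M i2 i2 < M i0 i2) × (M i2 i2 < M i2 i0) × (M i2 i0 < M i0 i2)

Reduced : Mat ℕ → Set
Reduced M = (∃[ m ] MagicSums M m) × DistinctEntries M × HasZero M × CornerOrder M

fromRows : ∀ {A : Set} → A → A → A → A → A → A → A → A → A → Mat A
fromRows a1 a2 a3 b1 b2 b3 c1 c2 c3 zero zero = a1
fromRows a1 a2 a3 b1 b2 b3 c1 c2 c3 zero (suc zero) = a2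
fromRows a1 a2 a3 b1 b2 b3 c1 c2 c3 zero (suc (suc zero)) = a3
fromRows a1 a2 a3 b1 b2 b3 c1 c2 c3 (suc zero) zero = b1
fromRows a1 a2 a3 b1 b2 b3 c1 c2 c3 (suc zero) (suc zero) = b2
fromRows a1 a2 a3 b1 b2 b3 c1 c2 c3 (suc zero) (suc (suc zero)) = b3
fromRows a1 a2 a3 b1 b2 b3 c1 c2 c3 (suc (suc zero)) zero = c1
fromRows a1 a2 a3 b1 b2 b3 c1 c2 c3 (suc (suc zero)) (suc zero) = c2
fromRows a1 a2 a3 b1 b2 b3 c1 c2 c3 (suc (suc zero)) (suc (suc zero)) = c3

Cm Dm T₁ : Mat ℤ
Cm = fromRows (+ 2) (+ 0) (+ 1)  (+ 0) (+ 1) (+ 2)  (+ 1) (+ 2) (+ 0)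
Dm = fromRows (+ 3) (+ 0) (+ 3)  (+ 2) (+ 2) (+ 2)  (+ 1) (+ 4) (+ 1)
T₁ = fromRows (+ 7) (+ 0) (+ 5)  (+ 2) (+ 4) (+ 6)  (+ 3) (+ 8) (+ 1)

IsDecomp : Mat ℕ → ℤ → ℤ → Set
IsDecomp M α β = ∀ i j → + (M i j) ≡ T₁ i j ℤ.+ α ℤ.* Cm i j ℤ.+ β ℤ.* Dm i j

Admissible : ℤ → ℤ → Set
Admissible α β = (-[1+ 0 ] ℤ.≤ α) × (+ 0 ℤ.≤ β)

{-# OPTIONS --safe #-}
-- In a 3 × 3 magic square the magic sum is 3e for the centre e, and entries opposite
-- through the centre add up to 2e. Together with c₃ < c₁ < a₃ this gives a₂ < c₃, and
-- writing c₃ = a₂ + 1 + s and c₁ = c₃ + 1 + r, every entry is a₂ plus the corresponding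
-- entry of T₁ + (r − 1) C + s D. So a₂ is the smallest entry, hence the zero, and
-- α = r − 1 ≥ −1, β = s ≥ 0. The corners c₁ = 3 + α + β and c₃ = 1 + β determine α and β.
module Submission where

open import Defs
open import Data.Nat using (ℕ; _+_; _*_; _<_; z≤n)
open import Data.Nat.Properties
  using (+-cancelˡ-≡; +-cancelʳ-≡; +-cancelʳ-<; *-cancelˡ-<; +-monoˡ-<; +-comm; +-identityʳ;
         m+n≡0⇒m≡0; m≤n⇒∃[o]m+o≡n; module ≤-Reasoning)
open import Data.Nat.Tactic.RingSolver using (solve)
open import Data.Integer as ℤ using (ℤ; +_; +≤+)
open import Data.Integer.Properties using (pos-+; pos-*; ⊖-monoˡ-≤)
import Data.Integer.Tactic.RingSolver as ℤ-Solver
open import Data.Fin using (zero; suc)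
open import Data.List using (_∷_; [])
open import Data.Product using (_×_; _,_; proj₁; proj₂; ∃-syntax)
open import Relation.Binary.PropositionalEquality
  using (_≡_; refl; sym; trans; cong; cong₂; module ≡-Reasoning)

-- Family r s is T₁ + (r − 1) C + s D computed in ℕ: at each position T₁ = t + c, C = c and D = d.
Family : ℕ → ℕ → Mat ℕ
Family r s = fromRows (entry 5 2 3) (entry 0 0 0) (entry 4 1 3)
                      (entry 2 0 2) (entry 3 1 2) (entry 4 2 2)
                      (entry 2 1 1) (entry 6 2 4) (entry 1 0 1)
  where
  entry : ℕ → ℕ → ℕ → ℕ
  entry t c d = t + c * r + d * s

entry-decomposition : ∀ r s t c d →
  + (t + c * r + d * s) ≡ + (t + c) ℤ.+ (+ r ℤ.- + 1) ℤ.* + c ℤ.+ + s ℤ.* + d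
entry-decomposition r s t c d = begin
  + (t + c * r + d * s)
    ≡⟨ pos-+ (t + c * r) (d * s) ⟩
  + (t + c * r) ℤ.+ + (d * s)
    ≡⟨ cong₂ ℤ._+_ (trans (pos-+ t (c * r)) (cong (ℤ._+_ (+ t)) (pos-* c r))) (pos-* d s) ⟩
  + t ℤ.+ + c ℤ.* + r ℤ.+ + d ℤ.* + s
    ≡⟨ shift (+ t) (+ c) (+ d) (+ r) (+ s) ⟩
  (+ t ℤ.+ + c) ℤ.+ (+ r ℤ.- + 1) ℤ.* + c ℤ.+ + s ℤ.* + d
    ≡⟨ cong (λ x → x ℤ.+ (+ r ℤ.- + 1) ℤ.* + c ℤ.+ + s ℤ.* + d) (pos-+ t c) ⟨
  + (t + c) ℤ.+ (+ r ℤ.- + 1) ℤ.* + c ℤ.+ + s ℤ.* + d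
    ∎
  where
  open ≡-Reasoning

  shift : ∀ (t c d x y : ℤ) →
          t ℤ.+ c ℤ.* x ℤ.+ d ℤ.* y ≡ (t ℤ.+ c) ℤ.+ (x ℤ.- + 1) ℤ.* c ℤ.+ y ℤ.* d
  shift = ℤ-Solver.solve-∀

family-decomposition : ∀ r s → IsDecomp (Family r s) (+ r ℤ.- + 1) (+ s)
family-decomposition r s zero             zero             = entry-decomposition r s 5 2 3
family-decomposition r s zero             (suc zero)       = entry-decomposition r s 0 0 0
family-decomposition r s zero             (suc (suc zero)) = entry-decomposition r s 4 1 3
family-decomposition r s (suc zero)       zero             = entry-decomposition r s 2 0 2
family-decomposition r s (suc zero)       (suc zero)       = entry-decomposition r s 3 1 2
family-decomposition r s (suc zero)       (suc (suc zero)) = entry-decomposition r s 4 2 2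
family-decomposition r s (suc (suc zero)) zero             = entry-decomposition r s 2 1 1
family-decomposition r s (suc (suc zero)) (suc zero)       = entry-decomposition r s 6 2 4
family-decomposition r s (suc (suc zero)) (suc (suc zero)) = entry-decomposition r s 1 0 1

decomposition-unique : ∀ {M α β α′ β′} → IsDecomp M α β → IsDecomp M α′ β′ → α′ ≡ α × β′ ≡ β
decomposition-unique {α = α} {β} {α′} {β′} d d′ =
    trans (α-from-corners α′ β′ d′) (sym (α-from-corners α β d))
  , trans (β-from-corner α′ β′ d′) (sym (β-from-corner α β d))
  where
  open ≡-Reasoning

  β-from-corner : ∀ {M} α β → IsDecomp M α β → β ≡ + M i2 i2 ℤ.- + 1
  β-from-corner {M} α β d = begin
    β                                          ≡⟨ ℤ-Solver.solve (α ∷ β ∷ []) ⟩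
    (+ 1 ℤ.+ α ℤ.* + 0 ℤ.+ β ℤ.* + 1) ℤ.- + 1  ≡⟨ cong (ℤ._- + 1) (d i2 i2) ⟨
    + M i2 i2 ℤ.- + 1                          ∎

  α-from-corners : ∀ {M} α β → IsDecomp M α β → α ≡ + M i2 i0 ℤ.- + M i2 i2 ℤ.- + 2
  α-from-corners {M} α β d = begin
    α
      ≡⟨ ℤ-Solver.solve (α ∷ β ∷ []) ⟩
    (+ 3 ℤ.+ α ℤ.* + 1 ℤ.+ β ℤ.* + 1) ℤ.- (+ 1 ℤ.+ α ℤ.* + 0 ℤ.+ β ℤ.* + 1) ℤ.- + 2
      ≡⟨ cong₂ (λ x y → x ℤ.- y ℤ.- + 2) (d i2 i0) (d i2 i2) ⟨
    + M i2 i0 ℤ.- + M i2 i2 ℤ.- + 2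
      ∎

module MagicSquare {a₁ a₂ a₃ b₁ b₂ b₃ c₁ c₂ c₃ m : ℕ}
                   (magic : MagicSums (fromRows a₁ a₂ a₃ b₁ b₂ b₃ c₁ c₂ c₃) m) where

  row₁ : a₁ + a₂ + a₃ ≡ m
  row₁ = proj₁ magic i0

  row₂ : b₁ + b₂ + b₃ ≡ m
  row₂ = proj₁ magic i1

  row₃ : c₁ + c₂ + c₃ ≡ m
  row₃ = proj₁ magic i2

  col₁ : a₁ + b₁ + c₁ ≡ m
  col₁ = proj₁ (proj₂ magic) i0

  col₂ : a₂ + b₂ + c₂ ≡ m
  col₂ = proj₁ (proj₂ magic) i1

  diag : a₁ + b₂ + c₃ ≡ m
  diag = proj₁ (proj₂ (proj₂ magic))

  antidiag : a₃ + b₂ + c₁ ≡ m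
  antidiag = proj₂ (proj₂ (proj₂ magic))

  -- The four lines through the centre cover every entry once and the centre three more times.
  m≡3*b₂ : m ≡ 3 * b₂
  m≡3*b₂ = +-cancelˡ-≡ (m + m + m) m (3 * b₂) (begin
    m + m + m + m
      ≡⟨ cong₂ _+_ (cong₂ _+_ (cong₂ _+_ row₂ col₂) diag) antidiag ⟨
    (b₁ + b₂ + b₃) + (a₂ + b₂ + c₂) + (a₁ + b₂ + c₃) + (a₃ + b₂ + c₁)
      ≡⟨ solve (a₁ ∷ a₂ ∷ a₃ ∷ b₁ ∷ b₂ ∷ b₃ ∷ c₁ ∷ c₂ ∷ c₃ ∷ []) ⟩
    (a₁ + a₂ + a₃) + (b₁ + b₂ + b₃) + (c₁ + c₂ + c₃) + 3 * b₂
      ≡⟨ cong (_+ 3 * b₂) (cong₂ _+_ (cong₂ _+_ row₁ row₂) row₃) ⟩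
    m + m + m + 3 * b₂
      ∎)
    where open ≡-Reasoning

  opposite-sum : ∀ x y → x + b₂ + y ≡ m → x + y ≡ 2 * b₂
  opposite-sum x y line = +-cancelʳ-≡ b₂ (x + y) (2 * b₂) (begin
    x + y + b₂   ≡⟨ solve (x ∷ y ∷ b₂ ∷ []) ⟩
    x + b₂ + y   ≡⟨ line ⟩
    m            ≡⟨ m≡3*b₂ ⟩
    3 * b₂       ≡⟨ solve (b₂ ∷ []) ⟩
    2 * b₂ + b₂  ∎)
    where open ≡-Reasoning

  a₂+b₂≡c₁+c₃ : a₂ + b₂ ≡ c₁ + c₃
  a₂+b₂≡c₁+c₃ = +-cancelʳ-≡ (2 * b₂ + 2 * b₂) (a₂ + b₂) (c₁ + c₃) (begin
    a₂ + b₂ + (2 * b₂ + 2 * b₂)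
      ≡⟨ cong (_+_ (a₂ + b₂))
              (cong₂ _+_ (opposite-sum a₁ c₃ diag) (opposite-sum a₃ c₁ antidiag)) ⟨
    a₂ + b₂ + ((a₁ + c₃) + (a₃ + c₁))
      ≡⟨ solve (a₁ ∷ a₂ ∷ a₃ ∷ b₂ ∷ c₁ ∷ c₃ ∷ []) ⟩
    (a₁ + a₂ + a₃) + b₂ + (c₁ + c₃)
      ≡⟨ cong (λ x → x + b₂ + (c₁ + c₃)) (trans row₁ m≡3*b₂) ⟩
    3 * b₂ + b₂ + (c₁ + c₃)
      ≡⟨ solve (b₂ ∷ c₁ ∷ c₃ ∷ []) ⟩
    c₁ + c₃ + (2 * b₂ + 2 * b₂)
      ∎)
    where open ≡-Reasoning

  a₂<c₃ : c₁ < a₃ → a₂ < c₃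
  a₂<c₃ c₁<a₃ = +-cancelʳ-< b₂ a₂ c₃ (begin-strict
    a₂ + b₂  ≡⟨ a₂+b₂≡c₁+c₃ ⟩
    c₁ + c₃  <⟨ +-monoˡ-< c₃ c₁<b₂ ⟩
    b₂ + c₃  ≡⟨ +-comm b₂ c₃ ⟩
    c₃ + b₂  ∎)
    where
    open ≤-Reasoning

    c₁<b₂ : c₁ < b₂
    c₁<b₂ = *-cancelˡ-< 2 c₁ b₂ (begin-strict
      2 * c₁   ≡⟨ solve (c₁ ∷ []) ⟩
      c₁ + c₁  <⟨ +-monoˡ-< c₁ c₁<a₃ ⟩
      a₃ + c₁  ≡⟨ opposite-sum a₃ c₁ antidiag ⟩
      2 * b₂   ∎)

  module _ {r s : ℕ} (c₁-gap : 1 + c₃ + r ≡ c₁) (c₃-gap : 1 + a₂ + s ≡ c₃) where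

    open ≡-Reasoning

    c₃-form : c₃ ≡ a₂ + Family r s i2 i2
    c₃-form = begin
      c₃                          ≡⟨ c₃-gap ⟨
      1 + a₂ + s                  ≡⟨ solve (a₂ ∷ r ∷ s ∷ []) ⟩
      a₂ + (1 + 0 * r + 1 * s)    ∎

    c₁-form : c₁ ≡ a₂ + Family r s i2 i0
    c₁-form = begin
      c₁                                  ≡⟨ c₁-gap ⟨
      1 + c₃ + r                          ≡⟨ cong (λ x → 1 + x + r) c₃-form ⟩
      1 + (a₂ + (1 + 0 * r + 1 * s)) + r  ≡⟨ solve (a₂ ∷ r ∷ s ∷ []) ⟩
      a₂ + (2 + 1 * r + 1 * s)            ∎

    b₂-form : b₂ ≡ a₂ + Family r s i1 i1
    b₂-form = +-cancelˡ-≡ a₂ b₂ _ (begin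
      a₂ + b₂
        ≡⟨ a₂+b₂≡c₁+c₃ ⟩
      c₁ + c₃
        ≡⟨ cong₂ _+_ c₁-form c₃-form ⟩
      a₂ + (2 + 1 * r + 1 * s) + (a₂ + (1 + 0 * r + 1 * s))
        ≡⟨ solve (a₂ ∷ r ∷ s ∷ []) ⟩
      a₂ + (a₂ + (3 + 1 * r + 2 * s))
        ∎)

    a₁-form : a₁ ≡ a₂ + Family r s i0 i0
    a₁-form = +-cancelʳ-≡ c₃ a₁ _ (begin
      a₁ + c₃
        ≡⟨ opposite-sum a₁ c₃ diag ⟩
      2 * b₂
        ≡⟨ cong (2 *_) b₂-form ⟩
      2 * (a₂ + (3 + 1 * r + 2 * s))
        ≡⟨ solve (a₂ ∷ r ∷ s ∷ []) ⟩
      a₂ + (5 + 2 * r + 3 * s) + (a₂ + (1 + 0 * r + 1 * s))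
        ≡⟨ cong (_+_ (a₂ + (5 + 2 * r + 3 * s))) c₃-form ⟨
      a₂ + (5 + 2 * r + 3 * s) + c₃
        ∎)

    a₃-form : a₃ ≡ a₂ + Family r s i0 i2
    a₃-form = +-cancelʳ-≡ c₁ a₃ _ (begin
      a₃ + c₁
        ≡⟨ opposite-sum a₃ c₁ antidiag ⟩
      2 * b₂
        ≡⟨ cong (2 *_) b₂-form ⟩
      2 * (a₂ + (3 + 1 * r + 2 * s))
        ≡⟨ solve (a₂ ∷ r ∷ s ∷ []) ⟩
      a₂ + (4 + 1 * r + 3 * s) + (a₂ + (2 + 1 * r + 1 * s))
        ≡⟨ cong (_+_ (a₂ + (4 + 1 * r + 3 * s))) c₁-form ⟨
      a₂ + (4 + 1 * r + 3 * s) + c₁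
        ∎)

    c₂-form : c₂ ≡ a₂ + Family r s i2 i1
    c₂-form = +-cancelˡ-≡ a₂ c₂ _ (begin
      a₂ + c₂
        ≡⟨ opposite-sum a₂ c₂ col₂ ⟩
      2 * b₂
        ≡⟨ cong (2 *_) b₂-form ⟩
      2 * (a₂ + (3 + 1 * r + 2 * s))
        ≡⟨ solve (a₂ ∷ r ∷ s ∷ []) ⟩
      a₂ + (a₂ + (6 + 2 * r + 4 * s))
        ∎)

    b₁-form : b₁ ≡ a₂ + Family r s i1 i0
    b₁-form = +-cancelʳ-≡ (a₁ + c₁) b₁ _ (begin
      b₁ + (a₁ + c₁)
        ≡⟨ solve (a₁ ∷ b₁ ∷ c₁ ∷ []) ⟩
      a₁ + b₁ + c₁
        ≡⟨ trans col₁ m≡3*b₂ ⟩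
      3 * b₂
        ≡⟨ cong (3 *_) b₂-form ⟩
      3 * (a₂ + (3 + 1 * r + 2 * s))
        ≡⟨ solve (a₂ ∷ r ∷ s ∷ []) ⟩
      a₂ + (2 + 0 * r + 2 * s) + ((a₂ + (5 + 2 * r + 3 * s)) + (a₂ + (2 + 1 * r + 1 * s)))
        ≡⟨ cong (_+_ (a₂ + (2 + 0 * r + 2 * s))) (cong₂ _+_ a₁-form c₁-form) ⟨
      a₂ + (2 + 0 * r + 2 * s) + (a₁ + c₁)
        ∎)

    b₃-form : b₃ ≡ a₂ + Family r s i1 i2
    b₃-form = +-cancelˡ-≡ b₁ b₃ _ (begin
      b₁ + b₃
        ≡⟨ opposite-sum b₁ b₃ row₂ ⟩
      2 * b₂
        ≡⟨ cong (2 *_) b₂-form ⟩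
      2 * (a₂ + (3 + 1 * r + 2 * s))
        ≡⟨ solve (a₂ ∷ r ∷ s ∷ []) ⟩
      a₂ + (2 + 0 * r + 2 * s) + (a₂ + (4 + 2 * r + 2 * s))
        ≡⟨ cong (_+ (a₂ + (4 + 2 * r + 2 * s))) b₁-form ⟨
      b₁ + (a₂ + (4 + 2 * r + 2 * s))
        ∎)

    gap-shape : ∀ i j → fromRows a₁ a₂ a₃ b₁ b₂ b₃ c₁ c₂ c₃ i j ≡ a₂ + Family r s i j
    gap-shape zero             zero             = a₁-form
    gap-shape zero             (suc zero)       = sym (+-identityʳ a₂)
    gap-shape zero             (suc (suc zero)) = a₃-form
    gap-shape (suc zero)       zero             = b₁-form
    gap-shape (suc zero)       (suc zero)       = b₂-form
    gap-shape (suc zero)       (suc (suc zero)) = b₃-form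
    gap-shape (suc (suc zero)) zero             = c₁-form
    gap-shape (suc (suc zero)) (suc zero)       = c₂-form
    gap-shape (suc (suc zero)) (suc (suc zero)) = c₃-form

  ordered-shape : c₃ < c₁ → c₁ < a₃ →
    ∃[ r ] ∃[ s ] (∀ i j → fromRows a₁ a₂ a₃ b₁ b₂ b₃ c₁ c₂ c₃ i j ≡ a₂ + Family r s i j)
  ordered-shape c₃<c₁ c₁<a₃ =
    let r , c₁-gap = m≤n⇒∃[o]m+o≡n c₃<c₁
        s , c₃-gap = m≤n⇒∃[o]m+o≡n (a₂<c₃ c₁<a₃)
    in r , s , gap-shape c₁-gap c₃-gap

fromEntries : ∀ {A : Set} → Mat A → Mat A
fromEntries M = fromRows (M i0 i0) (M i0 i1) (M i0 i2)
                         (M i1 i0) (M i1 i1) (M i1 i2)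
                         (M i2 i0) (M i2 i1) (M i2 i2)

fromEntries-η : ∀ {A : Set} (M : Mat A) i j → fromEntries M i j ≡ M i j
fromEntries-η M zero             zero             = refl
fromEntries-η M zero             (suc zero)       = refl
fromEntries-η M zero             (suc (suc zero)) = refl
fromEntries-η M (suc zero)       zero             = refl
fromEntries-η M (suc zero)       (suc zero)       = refl
fromEntries-η M (suc zero)       (suc (suc zero)) = refl
fromEntries-η M (suc (suc zero)) zero             = refl
fromEntries-η M (suc (suc zero)) (suc zero)       = refl
fromEntries-η M (suc (suc zero)) (suc (suc zero)) = refl

magicSums-fromEntries : ∀ {M m} → MagicSums M m → MagicSums (fromEntries M) m
magicSums-fromEntries (rows , cols , diag , antidiag) =
    (λ { zero → rows i0 ; (suc zero) → rows i1 ; (suc (suc zero)) → rows i2 })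
  , (λ { zero → cols i0 ; (suc zero) → cols i1 ; (suc (suc zero)) → cols i2 })
  , diag
  , antidiag

ordered-magic-shape : ∀ {M m} → MagicSums M m → CornerOrder M →
  ∃[ r ] ∃[ s ] (∀ i j → M i j ≡ M i0 i1 + Family r s i j)
ordered-magic-shape {M} magic (_ , _ , c₃<c₁ , c₁<a₃) =
  let r , s , shape = MagicSquare.ordered-shape (magicSums-fromEntries {M} magic) c₃<c₁ c₁<a₃
  in r , s , λ i j → trans (sym (fromEntries-η M i j)) (shape i j)

offset-of-zero : ∀ {M z} {F : Mat ℕ} → (∀ i j → M i j ≡ z + F i j) → HasZero M → z ≡ 0
offset-of-zero {z = z} shifted (i , j , Mij≡0) = m+n≡0⇒m≡0 z (trans (sym (shifted i j)) Mij≡0)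

reduced-in-family : ∀ {M} → Reduced M → ∃[ r ] ∃[ s ] (∀ i j → M i j ≡ Family r s i j)
reduced-in-family ((_ , magic) , _ , has-zero , order) =
  let r , s , shape = ordered-magic-shape magic order
  in r , s , λ i j → trans (shape i j) (cong (_+ Family r s i j) (offset-of-zero shape has-zero))

-- + r ℤ.- + 1 reduces to r ⊖ 1, and 0 ⊖ 1 to -[1+ 0 ].
family-admissible : ∀ r s → Admissible (+ r ℤ.- + 1) (+ s)
family-admissible r s = ⊖-monoˡ-≤ 1 (z≤n {r}) , +≤+ z≤n

lemma3p2 : (M : Mat ℕ) → Reduced M →
  ∃[ α ] ∃[ β ] ((Admissible α β × IsDecomp M α β) ×
    (∀ α′ β′ → Admissible α′ β′ → IsDecomp M α′ β′ → (α′ ≡ α × β′ ≡ β)))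
lemma3p2 M reduced =
  let r , s , M∈Family = reduced-in-family reduced

      decomposition : IsDecomp M (+ r ℤ.- + 1) (+ s)
      decomposition i j = trans (cong +_ (M∈Family i j)) (family-decomposition r s i j)
  in + r ℤ.- + 1 , + s , ((family-admissible r s , decomposition)
                         , λ _ _ _ → decomposition-unique decomposition)
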